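{- Let $D$ be a finite $3$-transitive digraph without loops, and let $H_1,H_2$ be spanning subdigraphs of $D$ with $A(H_1)\cap A(H_2)=\emptyset$ and $A(H_1)\cup A(H_2)=A(D)$. Suppose that $D$ contains no directed cycle of length $3$ and that $H_1$ and $H_2$ are acyclic. Then $D$ has a kernel.
   Context: A digraph $D$ is $3$-transitive if whenever $(u,v),(v,w),(w,x)$ are arcs of $D$ with $u\neq x$ (forming a directed path $u,v,w,x$), then $(u,x)$ is an arc of $D$. A digraph is acyclic if it has no directed cycle. A kernel of $D$ is a set $N\subseteq V(D)$ that is independent (no arcs between vertices of $N$) and absorbent (every vertex not in $N$ has an arc to some vertex of $N$). -}

module Defs where

open import Data.Nat using (ℕ; suc)
open import Data.Fin using (Fin; zero; suc; inject₁; fromℕ)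
open import Data.Bool using (Bool; true; false)
open import Data.Product using (Σ; ∃; _×_; _,_)
open import Relation.Nullary using (¬_)
open import Relation.Binary.PropositionalEquality using (_≡_; _≢_)
open import Function.Definitions using (Injective)

Digraph : ℕ → Set
Digraph n = Fin n → Fin n → Bool

Arc : ∀ {n} → Digraph n → Fin n → Fin n → Set
Arc D u v = D u v ≡ true

Loopless : ∀ {n} → Digraph n → Set
Loopless D = ∀ u → ¬ Arc D u u

ThreeTransitive : ∀ {n} → Digraph n → Set
ThreeTransitive D = ∀ u v w x → Arc D u v → Arc D v w → Arc D w x → u ≢ x → Arc D u x

-- A directed cycle of length (suc m) in D: pairwise distinct vertices
-- c 0, c 1, …, c m with arcs c i → c (i+1) for i < m and c m → c 0.
record DirectedCycle {n} (D : Digraph n) (m : ℕ) : Set where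
  field
    vtx      : Fin (suc m) → Fin n
    distinct : Injective _≡_ _≡_ vtx
    step     : ∀ (i : Fin m) → Arc D (vtx (inject₁ i)) (vtx (suc i))
    close    : Arc D (vtx (fromℕ m)) (vtx zero)

Acyclic : ∀ {n} → Digraph n → Set
Acyclic D = ∀ m → ¬ DirectedCycle D m

No3Cycle : ∀ {n} → Digraph n → Set
No3Cycle D = ¬ DirectedCycle D 2

-- H1, H2 are spanning subdigraphs of D whose arc sets partition A(D):
-- A(H1) ∩ A(H2) = ∅ and A(H1) ∪ A(H2) = A(D) (this forces A(Hi) ⊆ A(D)).
ArcPartition : ∀ {n} → Digraph n → Digraph n → Digraph n → Set
ArcPartition D H₁ H₂ =
  (∀ u v → Arc H₁ u v → Arc D u v) ×
  (∀ u v → Arc H₂ u v → Arc D u v) ×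
  (∀ u v → Arc H₁ u v → ¬ Arc H₂ u v) ×
  (∀ u v → Arc D u v → Arc H₁ u v ⊎ Arc H₂ u v)
  where open import Data.Sum using (_⊎_)

Independent : ∀ {n} → Digraph n → (Fin n → Bool) → Set
Independent D N = ∀ u v → N u ≡ true → N v ≡ true → ¬ Arc D u v

Absorbent : ∀ {n} → Digraph n → (Fin n → Bool) → Set
Absorbent D N = ∀ u → N u ≡ false → ∃ λ v → N v ≡ true × Arc D u v

IsKernel : ∀ {n} → Digraph n → (Fin n → Bool) → Set
IsKernel D N = Independent D N × Absorbent D N

HasKernel : ∀ {n} → Digraph n → Set
HasKernel D = ∃ λ N → IsKernel D N

-- Call an arc u → w of D asymmetric when w → u is not an arc. If v → w is asymmetric,
-- then 3-transitivity puts everything reachable from w in at most two steps within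
-- reach of v in at most two steps, while v itself (reachable in zero steps from v)
-- is not reachable from w in two steps, since that would close a directed 3-cycle.
-- So these closed 2-step out-neighbourhoods strictly shrink along asymmetric arcs,
-- and every nonempty set S of vertices contains a vertex u whose out-neighbours in S
-- all point back to u. Putting such a u into the kernel and recursing on S with u
-- and its in-neighbours removed yields a kernel of D.
module Submission where

open import Data.Nat using (ℕ)
open import Data.Bool using (true)
import Data.Bool.Properties as Bool
open import Data.Fin using (Fin; zero; suc; _≟_)
open import Data.Fin.Properties using (any?)
open import Data.Fin.Subset
  using (Subset; _∈_; _∉_; _⊆_; _⊂_; _∪_; ⁅_⁆; ⊤; Nonempty) renaming (⊥ to ∅)
open import Data.Fin.Subset.Properties
  using (_∈?_; nonempty?; ∉⊥; ∈⊤; x∈⁅x⁆; x∈⁅y⁆⇒x≡y; x∈p∪q⁺; x∈p∪q⁻)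
open import Data.Fin.Subset.Induction using (⊂-wellFounded)
open import Data.Vec using (tabulate; lookup)
open import Data.Vec.Properties using (lookup∘tabulate; lookup⇒[]=; []=⇒lookup)
open import Data.Product using (∃; _×_; _,_; proj₁; proj₂)
open import Data.Sum using ([_,_])
open import Data.Sum using (_⊎_; inj₁; inj₂)
open import Function using (_∘_; flip)
open import Induction.WellFounded using (WellFounded; Acc; acc; module Subrelation)
import Relation.Binary.Construct.On as On
open import Relation.Binary.PropositionalEquality using (_≡_; _≢_; refl; sym; trans)
open import Relation.Nullary using (¬_; Dec; yes; no; does; contradiction)
open import Relation.Nullary.Decidable using (dec-true; decidable-stable; _⊎-dec_; _×-dec_; ¬?)
open import Relation.Unary using (Pred; Decidable)
open import Defs

subset : ∀ {n ℓ} {P : Pred (Fin n) ℓ} → Decidable P → Subset n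
subset P? = tabulate (does ∘ P?)

module _ {n ℓ} {P : Pred (Fin n) ℓ} (P? : Decidable P) where

  ∈-subset⁺ : ∀ {x} → P x → x ∈ subset P?
  ∈-subset⁺ {x} px = lookup⇒[]= x _ (trans (lookup∘tabulate _ x) (dec-true (P? x) px))

  ∈-subset⁻ : ∀ {x} → x ∈ subset P? → P x
  ∈-subset⁻ {x} x∈ with P? x | trans (sym (lookup∘tabulate (does ∘ P?) x)) ([]=⇒lookup x∈)
  ... | yes px | _ = px
  ... | no _   | ()

module _ {n} (D : Digraph n) where

  arc? : ∀ u v → Dec (Arc D u v)
  arc? u v = D u v Bool.≟ true

  AsymArc : Fin n → Fin n → Set
  AsymArc u v = Arc D u v × ¬ Arc D v u

  QuasiSink : Subset n → Fin n → Set
  QuasiSink S u = u ∈ S × (∀ {w} → w ∈ S → Arc D u w → Arc D w u)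

  quasiSink-exists : WellFounded (flip AsymArc) → ∀ S → Nonempty S → ∃ (QuasiSink S)
  quasiSink-exists wf S (v , v∈S) = walk v v∈S (wf v)
    where
    walk : ∀ v → v ∈ S → Acc (flip AsymArc) v → ∃ (QuasiSink S)
    walk v v∈S (acc rs) with any? (λ w → (w ∈? S) ×-dec (arc? v w ×-dec ¬? (arc? w v)))
    ... | yes (w , w∈S , v⇢w) = walk w w∈S (rs v⇢w)
    ... | no none = v , v∈S , λ {w} w∈S vw →
      decidable-stable (arc? w v) (λ ¬wv → none (w , w∈S , vw , ¬wv))

  record InducedKernel (S : Subset n) : Set where
    field
      K           : Subset n
      K⊆S         : K ⊆ S
      independent : ∀ {u v} → u ∈ K → v ∈ K → ¬ Arc D u v
      absorbent   : ∀ {u} → u ∈ S → u ∉ K → ∃ λ v → v ∈ K × Arc D u v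

  emptyKernel : ∀ {S} → ¬ Nonempty S → InducedKernel S
  emptyKernel empty = record
    { K = ∅
    ; K⊆S = λ x∈∅ → contradiction x∈∅ ∉⊥
    ; independent = λ u∈∅ _ → contradiction u∈∅ ∉⊥
    ; absorbent = λ u∈S _ → contradiction (_ , u∈S) empty
    }

  module _ (loopless : Loopless D) (S : Subset n) {u} (sink : QuasiSink S u) where

    Remains : Pred (Fin n) _
    Remains x = x ∈ S × ¬ (x ≡ u ⊎ Arc D x u)

    remains? : Decidable Remains
    remains? x = (x ∈? S) ×-dec ¬? ((x ≟ u) ⊎-dec arc? x u)

    remainder : Subset n
    remainder = subset remains?

    ∈-remainder⁻ : ∀ {x} → x ∈ remainder → Remains x
    ∈-remainder⁻ = ∈-subset⁻ remains?

    ∈-remainder⁺ : ∀ {x} → Remains x → x ∈ remainder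
    ∈-remainder⁺ = ∈-subset⁺ remains?

    remainder⊂S : remainder ⊂ S
    remainder⊂S = proj₁ ∘ ∈-remainder⁻ , u , proj₁ sink , λ u∈ → proj₂ (∈-remainder⁻ u∈) (inj₁ refl)

    extendKernel : InducedKernel remainder → InducedKernel S
    extendKernel k = record { K = K ∪ ⁅ u ⁆ ; K⊆S = K∪u⊆S ; independent = indep ; absorbent = absorb }
      where
      open InducedKernel k

      split : ∀ {x} → x ∈ K ∪ ⁅ u ⁆ → x ∈ K ⊎ x ≡ u
      split x∈ with x∈p∪q⁻ K ⁅ u ⁆ x∈
      ... | inj₁ x∈K = inj₁ x∈K
      ... | inj₂ x∈u = inj₂ (x∈⁅y⁆⇒x≡y u x∈u)

      K∪u⊆S : K ∪ ⁅ u ⁆ ⊆ S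
      K∪u⊆S x∈ with split x∈
      ... | inj₁ x∈K = proj₁ (∈-remainder⁻ (K⊆S x∈K))
      ... | inj₂ refl = proj₁ sink

      indep : ∀ {a b} → a ∈ K ∪ ⁅ u ⁆ → b ∈ K ∪ ⁅ u ⁆ → ¬ Arc D a b
      indep a∈ b∈ with split a∈ | split b∈
      ... | inj₁ a∈K | inj₁ b∈K = independent a∈K b∈K
      ... | inj₁ a∈K | inj₂ refl = proj₂ (∈-remainder⁻ (K⊆S a∈K)) ∘ inj₂
      ... | inj₂ refl | inj₁ b∈K = λ ub →
        let b∈S , b∉inNbhd = ∈-remainder⁻ (K⊆S b∈K) in b∉inNbhd (inj₂ (proj₂ sink b∈S ub))
      ... | inj₂ refl | inj₂ refl = loopless _

      absorb : ∀ {x} → x ∈ S → x ∉ K ∪ ⁅ u ⁆ → ∃ λ v → v ∈ K ∪ ⁅ u ⁆ × Arc D x v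
      absorb {x} x∈S x∉ with arc? x u
      ... | yes xu = u , x∈p∪q⁺ (inj₂ (x∈⁅x⁆ u)) , xu
      ... | no ¬xu =
        let x≢u = λ { refl → x∉ (x∈p∪q⁺ (inj₂ (x∈⁅x⁆ u))) }
            v , v∈K , xv = absorbent (∈-remainder⁺ (x∈S , [ x≢u , ¬xu ]))
                                     (x∉ ∘ x∈p∪q⁺ ∘ inj₁)
        in v , x∈p∪q⁺ (inj₁ v∈K) , xv

  inducedKernel : Loopless D → (∀ S → Nonempty S → ∃ (QuasiSink S)) → ∀ S → InducedKernel S
  inducedKernel loopless sinks S = build S (⊂-wellFounded S)
    where
    build : ∀ S → Acc _⊂_ S → InducedKernel S
    build S (acc rs) with nonempty? S
    ... | no empty = emptyKernel empty
    ... | yes ne with sinks S ne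
    ... | u , sink = extendKernel loopless S sink (build _ (rs (remainder⊂S loopless S sink)))

  hasKernel-from-quasiSinks : Loopless D → (∀ S → Nonempty S → ∃ (QuasiSink S)) → HasKernel D
  hasKernel-from-quasiSinks loopless sinks = lookup K , independent′ , absorbent′
    where
    open InducedKernel (inducedKernel loopless sinks ⊤)

    independent′ : Independent D (lookup K)
    independent′ u v Ku Kv = independent (lookup⇒[]= u K Ku) (lookup⇒[]= v K Kv)

    absorbent′ : Absorbent D (lookup K)
    absorbent′ u Ku with absorbent ∈⊤ (λ u∈K → contradiction (trans (sym ([]=⇒lookup u∈K)) Ku) λ ())
    ... | v , v∈K , uv = v , []=⇒lookup v∈K , uv

module _ {n} {D : Digraph n} (loopless : Loopless D) where

  arc⇒≢ : ∀ {u v} → Arc D u v → u ≢ v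
  arc⇒≢ uv refl = loopless _ uv

  no3Cycle⇒¬triangle : No3Cycle D → ∀ {a b c} → Arc D a b → Arc D b c → ¬ Arc D c a
  no3Cycle⇒¬triangle no3 {a} {b} {c} ab bc ca = no3 record
    { vtx = vtx ; distinct = distinct ; step = λ { zero → ab ; (suc zero) → bc } ; close = ca }
    where
    vtx : Fin 3 → Fin n
    vtx zero = a
    vtx (suc zero) = b
    vtx (suc (suc zero)) = c

    distinct : ∀ {i j} → vtx i ≡ vtx j → i ≡ j
    distinct {zero}             {zero}             _ = refl
    distinct {suc zero}         {suc zero}         _ = refl
    distinct {suc (suc zero)}   {suc (suc zero)}   _ = refl
    distinct {zero}             {suc zero}         e = contradiction e (arc⇒≢ ab)
    distinct {suc zero}         {zero}             e = contradiction (sym e) (arc⇒≢ ab)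
    distinct {suc zero}         {suc (suc zero)}   e = contradiction e (arc⇒≢ bc)
    distinct {suc (suc zero)}   {suc zero}         e = contradiction (sym e) (arc⇒≢ bc)
    distinct {suc (suc zero)}   {zero}             e = contradiction e (arc⇒≢ ca)
    distinct {zero}             {suc (suc zero)}   e = contradiction (sym e) (arc⇒≢ ca)

module _ {n} (D : Digraph n) where

  Reach≤2 : Fin n → Pred (Fin n) _
  Reach≤2 v x = x ≡ v ⊎ Arc D v x ⊎ ∃ λ y → Arc D v y × Arc D y x

  reach≤2? : ∀ v → Decidable (Reach≤2 v)
  reach≤2? v x = (x ≟ v) ⊎-dec arc? D v x ⊎-dec any? (λ y → arc? D v y ×-dec arc? D y x)

  ball : Fin n → Subset n
  ball v = subset (reach≤2? v)

  reach≤2-pullback : ThreeTransitive D → ∀ {v w x} → Arc D v w → Reach≤2 w x → Reach≤2 v x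
  reach≤2-pullback _ vw (inj₁ refl) = inj₂ (inj₁ vw)
  reach≤2-pullback _ vw (inj₂ (inj₁ wx)) = inj₂ (inj₂ (_ , vw , wx))
  reach≤2-pullback threeTrans {v} {w} {x} vw (inj₂ (inj₂ (y , wy , yx))) with v ≟ x
  ... | yes refl = inj₁ refl
  ... | no v≢x = inj₂ (inj₁ (threeTrans v w y x vw wy yx v≢x))

  asymArc⇒¬reach≤2 : Loopless D → No3Cycle D → ∀ {v w} → AsymArc D v w → ¬ Reach≤2 w v
  asymArc⇒¬reach≤2 loopless _ (vw , _) (inj₁ v≡w) = arc⇒≢ loopless vw (sym v≡w)
  asymArc⇒¬reach≤2 _ _ (_ , ¬wv) (inj₂ (inj₁ wv)) = ¬wv wv
  asymArc⇒¬reach≤2 loopless no3 (vw , _) (inj₂ (inj₂ (_ , wy , yv))) =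
    no3Cycle⇒¬triangle loopless no3 vw wy yv

  asymArc-wellFounded : Loopless D → ThreeTransitive D → No3Cycle D → WellFounded (flip (AsymArc D))
  asymArc-wellFounded loopless threeTrans no3 =
    Subrelation.wellFounded ball-shrinks (On.wellFounded ball ⊂-wellFounded)
    where
    ball-shrinks : ∀ {w v} → AsymArc D v w → ball w ⊂ ball v
    ball-shrinks {w} {v} vw =
        ∈-subset⁺ (reach≤2? v) ∘ reach≤2-pullback threeTrans (proj₁ vw) ∘ ∈-subset⁻ (reach≤2? w)
      , v , ∈-subset⁺ (reach≤2? v) (inj₁ refl)
      , asymArc⇒¬reach≤2 loopless no3 vw ∘ ∈-subset⁻ (reach≤2? w)

mainTheorem11 : (n : ℕ) (D H₁ H₂ : Digraph n) →
    Loopless D → ThreeTransitive D → ArcPartition D H₁ H₂ →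
    No3Cycle D → Acyclic H₁ → Acyclic H₂ →
    HasKernel D
mainTheorem11 n D H₁ H₂ loopless threeTrans _ no3 _ _ =
  hasKernel-from-quasiSinks D loopless
    (quasiSink-exists D (asymArc-wellFounded D loopless threeTrans no3))
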